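{- Let $\mathcal{H}=\{H_k: k\ge1\}$ be the class of all hypercube graphs. The class $\mathcal{H}$ is $(\{0,1\},2)$-regular-decisional.
   Context: Hypercube graphs are regarded as structures over the vocabulary $\tau=(E)$ of directed graphs ($E$ binary): $H_k$ has domain $\{0,1\}^k$ and $E(H_k)$ is the set of pairs $(b_1\cdots b_k,b'_1\cdots b'_k)$ of $k$-bit strings that differ in exactly one position. Fix a padding symbol $\#$. For an alphabet $\Gamma$, $\Gamma^{\otimes a}$ is $\Gamma^a$ as an alphabet. For nonempty strings $u_1,\dots,u_a$, $u_1\otimes\cdots\otimes u_a$ is the string of length $\max|u_i|$ whose $j$-th symbol is the tuple of $j$-th symbols, with $\#$ for missing symbols; for alphabets $\Gamma_1\otimes\cdots\otimes\Gamma_a$ is the Cartesian product; $L^{\otimes a}=\{u_1\otimes\cdots\otimes u_a:u_i\in L\}$; $\mathcal{R}(L)=\{(u_1,\dots,u_a):u_1\otimes\cdots\otimes u_a\in L\}$. A relation is regular if the language of tensor products of its tuples is accepted by a finite automaton. ODDs. For an alphabet $\Gamma$ and $w\ge1$, a $(\Gamma,w)$-layer is $B=(\ell,r,T,I,F,\iota,\phi)$ with $\ell,r\subseteq\{0,\dots,w-1\}$, $T\subseteq\ell\times(\Gamma\sqcup\{\#\})\times r$, $I\subseteq\ell$, $F\subseteq r$, Booleans $\iota,\phi$, $I=\emptyset$ if $\iota$ false, $F=\emptyset$ if $\phi$ false; $\mathcal{B}(\Gamma,w)$ is the set of such layers. A $(\Gamma,w)$-ODD of length $k$ is $B_1\cdots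 B_k\in\mathcal{B}(\Gamma,w)^k$ with $\ell(B_{i+1})=r(B_i)$, $\iota(B_i)$ true iff $i=1$, $\phi(B_i)$ true iff $i=k$; $\mathcal{B}(\Gamma,w,k)$ is the set of them. A nonempty string over $\Gamma$ of length $\le k$ is accepted if, padded with $\#$ to length $k$ (symbols $\hat\sigma_i$), there are $(p_i,\hat\sigma_i,q_i)\in T(B_i)$ with $p_{i+1}=q_i$, $p_1\in I(B_1)$, $q_k\in F(B_k)$; $L(D)$ is the set of accepted strings. A tuple $(D_0,\dots,D_m)$ is $(\Sigma,w,\tau)$-structural for $\tau=(R_1,\dots,R_m)$ with arities $a_i$ if for some $k$, $D_0\in\mathcal{B}(\Sigma,w,k)$, $D_i\in\mathcal{B}(\Sigma^{\otimes a_i},w,k)$, $L(D_i)\subseteq L(D_0)^{\otimes a_i}$; its derived structure $\mathcal{S}(D_0,\dots,D_m)$ has domain $L(D_0)$ and interprets $R_i$ as $\mathcal{R}(L(D_i))$. $\mathcal{R}(\Sigma,w,\tau)$ is the set of all structural tuples; for $R\subseteq\mathcal{R}(\Sigma,w,\tau)$, $\mathcal{S}(R)$ is the class of all structures isomorphic to $\mathcal{S}(D)$ for some $D\in R$. A class $\mathcal{C}$ of finite $\tau$-structures is $(\Sigma,w)$-regular-decisional if $\mathcal{C}=\mathcal{S}(R)$ for some regular $R\subseteq\mathcal{R}(\Sigma,w,\tau)$. -}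

module Defs where

open import Data.Nat using (ℕ; zero; suc; _≤_; _≥_; _∸_)
open import Data.Bool using (Bool; true; false)
open import Data.Maybe using (Maybe; just; nothing)
open import Data.Product using (Σ; Σ-syntax; ∃; ∃-syntax; _×_; _,_)
open import Data.List using (List; []; _∷_; length; map; _++_; replicate)
open import Data.List.Relation.Unary.All using (All)
open import Data.Vec using (Vec; lookup)
open import Data.Fin using (Fin)
open import Data.Fin.Subset using (Subset; _∈_; _⊆_; ⊥)
open import Data.Empty renaming (⊥ to Empty)
open import Data.Unit using (⊤)
open import Relation.Binary.PropositionalEquality using (_≡_; _≢_)
open import Function.Bundles using (_↔_; _⇔_; Inverse)

-- The padding symbol # is `nothing`; Γ ⊔ {#} is `Maybe Γ`.
-- For a = 2, the alphabet Σ^{⊗2} is taken to be (Σ⊔{#}) × (Σ⊔{#}),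
-- so that u ⊗ v of strings of different lengths is a string over it.

_⊗²_ : Set → Set → Set
A ⊗² B = Maybe A × Maybe B

_⊗_ : {A B : Set} → List A → List B → List (A ⊗² B)
[]       ⊗ []       = []
(a ∷ as) ⊗ []       = (just a , nothing) ∷ (as ⊗ [])
[]       ⊗ (b ∷ bs) = (nothing , just b) ∷ ([] ⊗ bs)
(a ∷ as) ⊗ (b ∷ bs) = (just a , just b) ∷ (as ⊗ bs)

-- States are Fin w = {0,…,w-1}; subsets of states are `Subset w`;
-- the transition relation T ⊆ [w] × (Γ⊔{#}) × [w] is given by its
-- characteristic (Boolean) function.

record Layer (Γ : Set) (w : ℕ) : Set where
  constructor layer
  field
    ℓ : Subset w
    r : Subset w
    T : Fin w → Maybe Γ → Fin w → Bool
    I : Subset w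
    F : Subset w
    ι : Bool
    φ : Bool
open Layer public

WFLayer : {Γ : Set} {w : ℕ} → Layer Γ w → Set
WFLayer B =
  (∀ p s q → T B p s q ≡ true → (p ∈ ℓ B) × (q ∈ r B)) ×
  (I B ⊆ ℓ B) × (F B ⊆ r B) ×
  (ι B ≡ false → I B ≡ ⊥) × (φ B ≡ false → F B ≡ ⊥)

Linked : {Γ : Set} {w : ℕ} → List (Layer Γ w) → Set
Linked []             = ⊤
Linked (B ∷ [])       = ⊤
Linked (B ∷ B′ ∷ Bs)  = (ℓ B′ ≡ r B) × Linked (B′ ∷ Bs)

IotaOK : {Γ : Set} {w : ℕ} → List (Layer Γ w) → Set
IotaOK []       = ⊤
IotaOK (B ∷ Bs) = (ι B ≡ true) × All (λ B′ → ι B′ ≡ false) Bs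

PhiOK : {Γ : Set} {w : ℕ} → List (Layer Γ w) → Set
PhiOK []            = ⊤
PhiOK (B ∷ [])      = φ B ≡ true
PhiOK (B ∷ B′ ∷ Bs) = (φ B ≡ false) × PhiOK (B′ ∷ Bs)

IsODD : (Γ : Set) (w k : ℕ) → List (Layer Γ w) → Set
IsODD Γ w k D = (length D ≡ k) × All WFLayer D × Linked D × IotaOK D × PhiOK D

pad : {Γ : Set} → ℕ → List Γ → List (Maybe Γ)
pad k u = map just u ++ replicate (k ∸ length u) nothing

RunFrom : {Γ : Set} {w : ℕ} → List (Layer Γ w) → List (Maybe Γ) → Fin w → Set
RunFrom {w = w} (B ∷ [])      (s ∷ [])     p = Σ[ q ∈ Fin w ] (T B p s q ≡ true) × (q ∈ F B)
RunFrom {w = w} (B ∷ B′ ∷ Bs) (s ∷ s′ ∷ ss) p =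
  Σ[ q ∈ Fin w ] (T B p s q ≡ true) × RunFrom (B′ ∷ Bs) (s′ ∷ ss) q
RunFrom _ _ _ = Empty

Accepts : {Γ : Set} {w : ℕ} → List (Layer Γ w) → List Γ → Set
Accepts []                 u = Empty
Accepts {w = w} D@(B ∷ Bs) u =
  (length u ≥ 1) × (length u ≤ length D) ×
  Σ[ p ∈ Fin w ] (p ∈ I B) × RunFrom D (pad (length D) u) p

record Graph : Set₁ where
  field
    V : Set
    E : V → V → Set
open Graph public

_≅_ : Graph → Graph → Set
A ≅ B = Σ[ f ∈ (V A ↔ V B) ] (∀ x y → E A x y ⇔ E B (Inverse.to f x) (Inverse.to f y))

Hypercube : ℕ → Graph
Hypercube k = record
  { V = Vec Bool k
  ; E = λ u v → Σ[ i ∈ Fin k ] (lookup u i ≢ lookup v i) ×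
                  (∀ j → j ≢ i → lookup u j ≡ lookup v j) }

Structural : (Σ' : Set) (w : ℕ) → List (Layer Σ' w) → List (Layer (Σ' ⊗² Σ') w) → Set
Structural Σ' w D₀ D₁ =
  Σ[ k ∈ ℕ ] IsODD Σ' w k D₀ × IsODD (Σ' ⊗² Σ') w k D₁ ×
  (∀ s → Accepts D₁ s → Σ[ u ∈ List Σ' ] Σ[ v ∈ List Σ' ]
           Accepts D₀ u × Accepts D₀ v × (s ≡ u ⊗ v))

-- A ≅ 𝓢(D₀,D₁), unfolded: a bijection f from V A onto L(D₀) with
-- E^A(a,b) ⇔ (f a, f b) ∈ 𝓡(L(D₁)), i.e. f a ⊗ f b ∈ L(D₁).
IsoDerived : {Σ' : Set} {w : ℕ} → Graph →
             List (Layer Σ' w) → List (Layer (Σ' ⊗² Σ') w) → Set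
IsoDerived {Σ'} A D₀ D₁ =
  Σ[ f ∈ (V A → List Σ') ]
    (∀ a → Accepts D₀ (f a)) ×
    (∀ a b → f a ≡ f b → a ≡ b) ×
    (∀ u → Accepts D₀ u → Σ[ a ∈ V A ] f a ≡ u) ×
    (∀ a b → E A a b ⇔ Accepts D₁ (f a ⊗ f b))

record DFA (A : Set) : Set where
  field
    n     : ℕ
    δ     : Fin n → A → Fin n
    start : Fin n
    acc   : Fin n → Bool

runDFA : {A : Set} (M : DFA A) → Fin (DFA.n M) → List A → Fin (DFA.n M)
runDFA M q []       = q
runDFA M q (a ∷ as) = runDFA M (DFA.δ M q a) as

AcceptsDFA : {A : Set} → DFA A → List A → Set
AcceptsDFA M s = DFA.acc M (runDFA M (DFA.start M) s) ≡ true

RegularRel : {A B : Set} → (List A → List B → Set) → Set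
RegularRel {A} {B} R =
  Σ[ M ∈ DFA (A ⊗² B) ] ∀ s →
    AcceptsDFA M s ⇔ (Σ[ D₀ ∈ List A ] Σ[ D₁ ∈ List B ] R D₀ D₁ × (s ≡ D₀ ⊗ D₁))

RegularDecisional : (Σ' : Set) (w : ℕ) → (Graph → Set) → Set₁
RegularDecisional Σ' w C =
  Σ[ R ∈ (List (Layer Σ' w) → List (Layer (Σ' ⊗² Σ') w) → Set) ]
    (∀ D₀ D₁ → R D₀ D₁ → Structural Σ' w D₀ D₁) ×
    RegularRel R ×
    (∀ A → C A ⇔ (Σ[ D₀ ∈ List (Layer Σ' w) ] Σ[ D₁ ∈ List (Layer (Σ' ⊗² Σ') w) ]
                    R D₀ D₁ × IsoDerived A D₀ D₁))

IsHypercube : Graph → Set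
IsHypercube A = Σ[ k ∈ ℕ ] (k ≥ 1) × (A ≅ Hypercube k)

-- Hypercubes are derived from uniform ODDs: unroll a 2-state automaton k times, one copy per
-- layer. An unrolling accepts exactly the length-k words accepted by the automaton, so unrolling
-- an automaton that accepts every word gives the domain {0,1}^k, and unrolling one that reads
-- u ⊗ v and counts (up to one) the positions where u and v differ gives the edge relation of H_k.
-- The relation R pairs equal-length unrollings of these two automata. Every pair in R derives
-- H_k, H_k is derived from the pair of length k, and derived structures are determined up to
-- isomorphism. R is regular: a DFA reading (D₀ , D₁) layer by layer compares each layer with the
-- expected copy of the automaton, which is decidable because every component of a layer ranges
-- over a finite set.

module Submission where

open import Defs
open import Data.Bool using (Bool; true; false; not; if_then_else_; _≟_)
open import Data.Nat using (ℕ; zero; suc; pred; _≥_; _∸_; s≤s; z≤n)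
open import Data.Nat.Properties using (n∸n≡0; m∸n≡0⇒m≤n; ≤-antisym; ≤-reflexive)
open import Data.Maybe using (Maybe; just; nothing)
open import Data.Product using (Σ-syntax; ∃-syntax; _×_; _,_; proj₁; proj₂)
open import Data.List using (List; []; _∷_; length; map; _++_; replicate)
open import Data.List.Properties using (length-map; ++-identityʳ)
open import Data.List.Relation.Unary.All using (All; []; _∷_)
open import Data.Vec using (Vec; []; _∷_; lookup; toList; fromList)
open import Data.Vec.Properties
  using ( ≡-dec; toList-injective; cast-is-id; toList∘fromList; length-toList
        ; tabulate∘lookup; tabulate-cong)
open import Data.Fin using (Fin; zero; suc)
open import Data.Fin.Properties using (all?; suc-injective)
open import Data.Fin.Subset using (Subset; _∈_; ⊤; ⊥; ⁅_⁆)
open import Data.Fin.Subset.Properties using (∈⊤; x∈⁅x⁆; x∈⁅y⁆⇒x≡y)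
open import Data.Empty using (⊥-elim)
open import Data.Unit using (tt)
open import Function using (_∘_)
open import Function.Bundles using (_⇔_; mk⇔; mk↔ₛ′; Inverse; Equivalence)
open import Function.Construct.Composition using (_⇔-∘_)
open import Function.Construct.Symmetry using (⇔-sym)
open import Relation.Nullary using (Dec; does; yes; no; ¬_; contradiction)
open import Relation.Nullary.Decidable using (map′; _×-dec_; dec-true; dec-false)
open import Relation.Unary using (Decidable)
open import Relation.Binary.PropositionalEquality
  using (_≡_; _≢_; refl; sym; trans; cong; subst; subst₂)

private variable
  Γ Δ Σ′ : Set
  w w′ k : ℕ

Searchable : Set → Set₁
Searchable A = ∀ {P : A → Set} → Decidable P → Dec (∀ a → P a)

search-Bool : Searchable Bool
search-Bool P? = map′ (λ (f , t) → λ { false → f ; true → t }) (λ p → p false , p true)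
                      (P? false ×-dec P? true)

search-Maybe : Searchable Γ → Searchable (Maybe Γ)
search-Maybe search P? = map′ (λ (n , j) → λ { nothing → n ; (just a) → j a })
                               (λ p → p nothing , p ∘ just)
                               (P? nothing ×-dec search (P? ∘ just))

search-× : Searchable Γ → Searchable Δ → Searchable (Γ × Δ)
search-× search-Γ search-Δ P? =
  map′ (λ p (a , b) → p a b) (λ p a b → p (a , b)) (search-Γ λ a → search-Δ λ b → P? (a , b))

-- Layers carry transition functions, so only extensional equality of layers is decidable.
record _≈ᴸ_ (B B′ : Layer Γ w) : Set where
  field
    ℓ≡ : ℓ B ≡ ℓ B′
    r≡ : r B ≡ r B′
    T≗ : ∀ p s q → T B p s q ≡ T B′ p s q
    I≡ : I B ≡ I B′
    F≡ : F B ≡ F B′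
    ι≡ : ι B ≡ ι B′
    φ≡ : φ B ≡ φ B′
open _≈ᴸ_

≈ᴸ-dec : Searchable Γ → (B B′ : Layer Γ w) → Dec (B ≈ᴸ B′)
≈ᴸ-dec search B B′ =
  map′ (λ (a , b , c , d , e , f , g) → record
          { ℓ≡ = a ; r≡ = b ; T≗ = c ; I≡ = d ; F≡ = e ; ι≡ = f ; φ≡ = g })
       (λ e → ℓ≡ e , r≡ e , T≗ e , I≡ e , F≡ e , ι≡ e , φ≡ e)
       (ℓ B ≟ˢ ℓ B′ ×-dec r B ≟ˢ r B′ ×-dec T≗? ×-dec I B ≟ˢ I B′ ×-dec F B ≟ˢ F B′ ×-dec
        ι B ≟ ι B′ ×-dec φ B ≟ φ B′)
  where
  _≟ˢ_ = ≡-dec _≟_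
  T≗? = all? λ p → search-Maybe search λ s → all? λ q → T B p s q ≟ T B′ p s q

≈ᴸ-refl : {B : Layer Γ w} → B ≈ᴸ B
≈ᴸ-refl = record
  { ℓ≡ = refl ; r≡ = refl ; T≗ = λ _ _ _ → refl ; I≡ = refl ; F≡ = refl ; ι≡ = refl ; φ≡ = refl }

-- Transitions read padded symbols, so that they can serve verbatim as the table of a layer.
record NFA (Γ : Set) (w : ℕ) : Set where
  field
    δ       : Fin w → Maybe Γ → Fin w → Bool
    initial : Subset w
    final   : Subset w
open NFA

private variable
  N : NFA Γ w

layerAt : NFA Γ w → Bool → Bool → Layer Γ w
layerAt N i f = layer ⊤ ⊤ (δ N) (if i then initial N else ⊥) (if f then final N else ⊥) i f

-- The flag records whether the list starts with the first layer of the ODD.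
data Unrolls (N : NFA Γ w) : Bool → List (Layer Γ w) → Set where
  [_] : ∀ {i B} → B ≈ᴸ layerAt N i true → Unrolls N i (B ∷ [])
  _∷_ : ∀ {i B B′ Bs} → B ≈ᴸ layerAt N i false → Unrolls N false (B′ ∷ Bs) →
        Unrolls N i (B ∷ B′ ∷ Bs)

_∷ᵘ_ : ∀ {i B Bs} → B ≈ᴸ layerAt N i false → Unrolls N false Bs → Unrolls N i (B ∷ Bs)
e ∷ᵘ U@([ _ ]) = e ∷ U
e ∷ᵘ U@(_ ∷ _) = e ∷ U

Unrolls-head : ∀ {i B Bs} → Unrolls N i (B ∷ Bs) → ∃[ f ] B ≈ᴸ layerAt N i f
Unrolls-head [ e ]   = true , e
Unrolls-head (e ∷ _) = false , e

unrolling : NFA Γ w → Bool → ℕ → List (Layer Γ w)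
unrolling N i zero    = layerAt N i true ∷ []
unrolling N i (suc n) = layerAt N i false ∷ unrolling N false n

unrolling-Unrolls : ∀ (N : NFA Γ w) i n → Unrolls N i (unrolling N i n)
unrolling-Unrolls N i zero    = [ ≈ᴸ-refl ]
unrolling-Unrolls N i (suc n) = ≈ᴸ-refl ∷ᵘ unrolling-Unrolls N false n

length-unrolling : ∀ (N : NFA Γ w) i n → length (unrolling N i n) ≡ suc n
length-unrolling N i zero    = refl
length-unrolling N i (suc n) = cong suc (length-unrolling N false n)

Unrolls⇒length≥1 : ∀ {i D} → Unrolls N i D → length D ≥ 1
Unrolls⇒length≥1 [ _ ]   = s≤s z≤n
Unrolls⇒length≥1 (_ ∷ _) = s≤s z≤n

≈layerAt⇒WFLayer : ∀ {i f} {B : Layer Γ w} → B ≈ᴸ layerAt N i f → WFLayer B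
≈layerAt⇒WFLayer {N = N} e =
  (λ p _ q _ → ∈ℓ p , ∈r q) , (λ _ → ∈ℓ _) , (λ _ → ∈r _) ,
  (λ ι≡false → trans (I≡ e) (cong (λ j → if j then initial N else ⊥) (trans (sym (ι≡ e)) ι≡false))) ,
  (λ φ≡false → trans (F≡ e) (cong (λ j → if j then final N else ⊥) (trans (sym (φ≡ e)) φ≡false)))
  where
  ∈ℓ = λ x → subst (x ∈_) (sym (ℓ≡ e)) ∈⊤
  ∈r = λ x → subst (x ∈_) (sym (r≡ e)) ∈⊤

module _ {N : NFA Γ w} where

  Unrolls⇒All-WFLayer : ∀ {i D} → Unrolls N i D → All WFLayer D
  Unrolls⇒All-WFLayer [ e ]   = ≈layerAt⇒WFLayer {N = N} e ∷ []
  Unrolls⇒All-WFLayer (e ∷ U) = ≈layerAt⇒WFLayer {N = N} e ∷ Unrolls⇒All-WFLayer U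

  Unrolls⇒Linked : ∀ {i D} → Unrolls N i D → Linked D
  Unrolls⇒Linked [ _ ]   = tt
  Unrolls⇒Linked (e ∷ U) = trans (ℓ≡ (proj₂ (Unrolls-head U))) (sym (r≡ e)) , Unrolls⇒Linked U

  Unrolls⇒All-¬ι : ∀ {D} → Unrolls N false D → All (λ B → ι B ≡ false) D
  Unrolls⇒All-¬ι [ e ]   = ι≡ e ∷ []
  Unrolls⇒All-¬ι (e ∷ U) = ι≡ e ∷ Unrolls⇒All-¬ι U

  Unrolls⇒IotaOK : ∀ {D} → Unrolls N true D → IotaOK D
  Unrolls⇒IotaOK [ e ]   = ι≡ e , []
  Unrolls⇒IotaOK (e ∷ U) = ι≡ e , Unrolls⇒All-¬ι U

  Unrolls⇒PhiOK : ∀ {i D} → Unrolls N i D → PhiOK D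
  Unrolls⇒PhiOK [ e ]   = φ≡ e
  Unrolls⇒PhiOK (e ∷ U) = φ≡ e , Unrolls⇒PhiOK U

  Unrolls⇒IsODD : ∀ {D} → Unrolls N true D → length D ≡ k → IsODD Γ w k D
  Unrolls⇒IsODD U len =
    len , Unrolls⇒All-WFLayer U , Unrolls⇒Linked U , Unrolls⇒IotaOK U , Unrolls⇒PhiOK U

Reaches : NFA Γ w → List (Maybe Γ) → Fin w → Set
Reaches N []       p = p ∈ final N
Reaches N (s ∷ ss) p = Σ[ q ∈ Fin _ ] δ N p s q ≡ true × Reaches N ss q

AcceptsOfLength : NFA Γ w → ℕ → List Γ → Set
AcceptsOfLength N n u = length u ≡ n × ∃[ p ] p ∈ initial N × Reaches N (map just u) p

RejectsPadding : NFA Γ w → Set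
RejectsPadding N = ∀ p q → δ N p nothing q ≡ false

module _ {N : NFA Γ w} where

  run⇒Reaches : ∀ {i D} → Unrolls N i D → ∀ ss {p} → RunFrom D ss p →
                length ss ≡ length D × Reaches N ss p
  run⇒Reaches [ e ]   (s ∷ [])      (q , t , q∈F) =
    refl , q , trans (sym (T≗ e _ s q)) t , subst (q ∈_) (F≡ e) q∈F
  run⇒Reaches (e ∷ U) (s ∷ s′ ∷ ss) (q , t , run) =
    let len , reach = run⇒Reaches U (s′ ∷ ss) run
    in cong suc len , q , trans (sym (T≗ e _ s q)) t , reach
  run⇒Reaches [ _ ]   []          ()
  run⇒Reaches [ _ ]   (_ ∷ _ ∷ _) ()
  run⇒Reaches (_ ∷ _) []          ()
  run⇒Reaches (_ ∷ _) (_ ∷ [])    ()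

  Reaches⇒run : ∀ {i D} → Unrolls N i D → ∀ ss {p} → length ss ≡ length D → Reaches N ss p →
                RunFrom D ss p
  Reaches⇒run [ e ]   (s ∷ [])      _   (q , t , q∈F) =
    q , trans (T≗ e _ s q) t , subst (q ∈_) (sym (F≡ e)) q∈F
  Reaches⇒run (e ∷ U) (s ∷ s′ ∷ ss) len (q , t , reach) =
    q , trans (T≗ e _ s q) t , Reaches⇒run U (s′ ∷ ss) (cong pred len) reach
  Reaches⇒run [ _ ]   []            ()
  Reaches⇒run [ _ ]   (_ ∷ _ ∷ _)   ()
  Reaches⇒run (_ ∷ _) []            ()
  Reaches⇒run (_ ∷ _) (_ ∷ [])      ()

  padding-unreachable : RejectsPadding N → ∀ xs {ys p} → ¬ Reaches N (xs ++ nothing ∷ ys) p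
  padding-unreachable rejects []       (q , t , _) = contradiction (trans (sym (rejects _ q)) t) λ ()
  padding-unreachable rejects (_ ∷ xs) (_ , _ , reach) = padding-unreachable rejects xs reach

  Reaches-padded⇒unpadded : RejectsPadding N → ∀ u m {p} →
                            Reaches N (map just u ++ replicate m nothing) p → m ≡ 0
  Reaches-padded⇒unpadded _       _ zero    _     = refl
  Reaches-padded⇒unpadded rejects u (suc m) reach =
    ⊥-elim (padding-unreachable rejects (map just u) reach)

pad-full : ∀ (u : List Γ) → length u ≡ k → pad k u ≡ map just u
pad-full u refl rewrite n∸n≡0 (length u) = ++-identityʳ (map just u)

module _ {N : NFA Γ w} (rejects : RejectsPadding N) where

  private
    Accepts⇔AcceptsOfLength-∷ : ∀ {B Bs} → Unrolls N true (B ∷ Bs) → ∀ u →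
      Accepts (B ∷ Bs) u ⇔ AcceptsOfLength N (length (B ∷ Bs)) u
    Accepts⇔AcceptsOfLength-∷ {B} {Bs} U u = mk⇔ to from
      where
      n = length (B ∷ Bs)
      I≡initial : I B ≡ initial N
      I≡initial = I≡ (proj₂ (Unrolls-head U))

      to : Accepts (B ∷ Bs) u → AcceptsOfLength N n u
      to (_ , u≤n , p , p∈I , run) =
        let _ , reach = run⇒Reaches U (pad n u) run
            u≡n = ≤-antisym u≤n (m∸n≡0⇒m≤n (Reaches-padded⇒unpadded rejects u (n ∸ length u) reach))
        in u≡n , p , subst (p ∈_) I≡initial p∈I , subst (λ ss → Reaches N ss p) (pad-full u u≡n) reach

      from : AcceptsOfLength N n u → Accepts (B ∷ Bs) u
      from (u≡n , p , p∈I , reach) =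
        subst (_≥ 1) (sym u≡n) (s≤s z≤n) , ≤-reflexive u≡n , p , subst (p ∈_) (sym I≡initial) p∈I ,
        Reaches⇒run U (pad n u) (trans (cong length (pad-full u u≡n)) (trans (length-map just u) u≡n))
          (subst (λ ss → Reaches N ss p) (sym (pad-full u u≡n)) reach)

  Accepts⇔AcceptsOfLength : ∀ {D} → Unrolls N true D → ∀ u →
                            Accepts D u ⇔ AcceptsOfLength N (length D) u
  Accepts⇔AcceptsOfLength U@([ _ ]) = Accepts⇔AcceptsOfLength-∷ U
  Accepts⇔AcceptsOfLength U@(_ ∷ _) = Accepts⇔AcceptsOfLength-∷ U

module UnrollingPairs (N₀ : NFA Γ w) (N₁ : NFA Δ w′)
                      (search-Γ : Searchable Γ) (search-Δ : Searchable Δ) where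

  UnrollingsFrom : Bool → List (Layer Γ w) → List (Layer Δ w′) → Set
  UnrollingsFrom i D₀ D₁ = Unrolls N₀ i D₀ × Unrolls N₁ i D₁ × length D₀ ≡ length D₁

  Matches : Bool → Bool → Layer Γ w → Layer Δ w′ → Set
  Matches i f B C = B ≈ᴸ layerAt N₀ i f × C ≈ᴸ layerAt N₁ i f

  matches? : ∀ i f B C → Dec (Matches i f B C)
  matches? i f B C = ≈ᴸ-dec search-Γ B _ ×-dec ≈ᴸ-dec search-Δ C _

  expecting : Bool → Fin 4
  expecting true  = zero
  expecting false = suc zero

  accepted rejected : Fin 4
  accepted = suc (suc zero)
  rejected = suc (suc (suc zero))

  advance : Bool → Layer Γ w → Layer Δ w′ → Fin 4
  advance i B C with matches? i true B C | matches? i false B C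
  ... | yes _ | _     = accepted
  ... | no _  | yes _ = expecting false
  ... | no _  | no _  = rejected

  step : Fin 4 → Layer Γ w ⊗² Layer Δ w′ → Fin 4
  step zero       (just B , just C) = advance true B C
  step (suc zero) (just B , just C) = advance false B C
  step _          _                 = rejected

  isAccepted : Fin 4 → Bool
  isAccepted (suc (suc zero)) = true
  isAccepted _                = false

  automaton : DFA (Layer Γ w ⊗² Layer Δ w′)
  automaton = record { n = 4 ; δ = step ; start = expecting true ; acc = isAccepted }

  AcceptsFrom : Fin 4 → List (Layer Γ w ⊗² Layer Δ w′) → Set
  AcceptsFrom q s = isAccepted (runDFA automaton q s) ≡ true

  rejected-rejects : ∀ s → ¬ AcceptsFrom rejected s
  rejected-rejects []      ()
  rejected-rejects (_ ∷ s) = rejected-rejects s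

  accepted-only-[] : ∀ s → AcceptsFrom accepted s → s ≡ []
  accepted-only-[] []      _   = refl
  accepted-only-[] (_ ∷ s) acc = ⊥-elim (rejected-rejects s acc)

  step-expecting : ∀ i B C → step (expecting i) (just B , just C) ≡ advance i B C
  step-expecting true  _ _ = refl
  step-expecting false _ _ = refl

  advance-last : ∀ {i B C} → Matches i true B C → advance i B C ≡ accepted
  advance-last {i} {B} {C} m with matches? i true B C
  ... | yes _ = refl
  ... | no ¬m = contradiction m ¬m

  advance-inner : ∀ {i B C} → Matches i false B C → advance i B C ≡ expecting false
  advance-inner {i} {B} {C} m with matches? i true B C | matches? i false B C
  ... | yes (last , _) | _     = contradiction (trans (sym (φ≡ last)) (φ≡ (proj₁ m))) λ ()
  ... | no _           | yes _ = refl
  ... | no _           | no ¬m = contradiction m ¬m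

  Unzips : Bool → List (Layer Γ w ⊗² Layer Δ w′) → Set
  Unzips i s =
    Σ[ D₀ ∈ List (Layer Γ w) ] Σ[ D₁ ∈ List (Layer Δ w′) ] UnrollingsFrom i D₀ D₁ × s ≡ D₀ ⊗ D₁

  sound : ∀ i s → AcceptsFrom (expecting i) s → Unzips i s
  sound-advance : ∀ i B C s → AcceptsFrom (advance i B C) s → Unzips i ((just B , just C) ∷ s)

  sound true  []                      ()
  sound false []                      ()
  sound i     ((just B , just C) ∷ s) acc =
    sound-advance i B C s (subst (λ q → AcceptsFrom q s) (step-expecting i B C) acc)
  sound true  ((nothing , _) ∷ s)      acc = ⊥-elim (rejected-rejects s acc)
  sound false ((nothing , _) ∷ s)      acc = ⊥-elim (rejected-rejects s acc)
  sound true  ((just _ , nothing) ∷ s) acc = ⊥-elim (rejected-rejects s acc)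
  sound false ((just _ , nothing) ∷ s) acc = ⊥-elim (rejected-rejects s acc)

  sound-advance i B C s acc with matches? i true B C | matches? i false B C
  ... | yes (e₀ , e₁) | _ =
    B ∷ [] , C ∷ [] , ([ e₀ ] , [ e₁ ] , refl) , cong (_ ∷_) (accepted-only-[] s acc)
  ... | no _ | yes (e₀ , e₁) with sound false s acc
  ...   | D₀ , D₁ , (U₀ , U₁ , len) , refl =
    B ∷ D₀ , C ∷ D₁ , (e₀ ∷ᵘ U₀ , e₁ ∷ᵘ U₁ , cong suc len) , refl
  sound-advance i B C s acc | no _ | no _ = ⊥-elim (rejected-rejects s acc)

  complete : ∀ {i D₀ D₁} → UnrollingsFrom i D₀ D₁ → AcceptsFrom (expecting i) (D₀ ⊗ D₁)
  complete {i} {B ∷ []} {C ∷ []} ([ e₀ ] , [ e₁ ] , _) =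
    subst (λ q → AcceptsFrom q []) (sym (trans (step-expecting i B C) (advance-last (e₀ , e₁)))) refl
  complete {i} {B ∷ D₀} {C ∷ D₁} (e₀ ∷ U₀ , e₁ ∷ U₁ , len) =
    subst (λ q → AcceptsFrom q (D₀ ⊗ D₁))
          (sym (trans (step-expecting i B C) (advance-inner (e₀ , e₁))))
          (complete (U₀ , U₁ , cong pred len))
  complete ([ _ ] , _ ∷ _ , ())
  complete (_ ∷ _ , [ _ ] , ())

  Unrollings : List (Layer Γ w) → List (Layer Δ w′) → Set
  Unrollings = UnrollingsFrom true

  Unrollings-regular : RegularRel Unrollings
  Unrollings-regular = automaton , λ s → mk⇔ (sound true s) λ { (_ , _ , U , refl) → complete U }

letters : NFA Γ (suc w)
letters = record
  { δ = λ { zero (just _) zero → true ; _ _ _ → false } ; initial = ⁅ zero ⁆ ; final = ⁅ zero ⁆ }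

letters-rejects-padding : RejectsPadding (letters {Γ} {w})
letters-rejects-padding zero    _ = refl
letters-rejects-padding (suc _) _ = refl

Reaches-letters : ∀ (u : List Γ) → Reaches (letters {w = w}) (map just u) zero
Reaches-letters []      = x∈⁅x⁆ zero
Reaches-letters (_ ∷ u) = zero , refl , Reaches-letters u

Accepts-letters : ∀ {D} → Unrolls (letters {Γ} {w}) true D → ∀ u → Accepts D u ⇔ length u ≡ length D
Accepts-letters U u =
  mk⇔ (proj₁ ∘ Equivalence.to accepts)
      (λ len → Equivalence.from accepts (len , zero , x∈⁅x⁆ zero , Reaches-letters u))
  where accepts = Accepts⇔AcceptsOfLength letters-rejects-padding U u

data FlipStep : Fin 2 → Fin 2 → Bool → Bool → Set where
  keep : ∀ {p a} → FlipStep p p a a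
  flip : ∀ {a b} → a ≢ b → FlipStep zero (suc zero) a b

flipStep : Fin 2 → Fin 2 → Bool → Bool → Bool
flipStep zero       zero       a b = does (a ≟ b)
flipStep zero       (suc zero) a b = not (does (a ≟ b))
flipStep (suc zero) (suc zero) a b = does (a ≟ b)
flipStep (suc zero) zero       _ _ = false

flipStep-sound : ∀ p q a b → flipStep p q a b ≡ true → FlipStep p q a b
flipStep-sound zero zero a b e with a ≟ b
... | yes refl = keep
... | no _     = contradiction e λ ()
flipStep-sound zero (suc zero) a b e with a ≟ b
... | yes _   = contradiction e λ ()
... | no a≢b  = flip a≢b
flipStep-sound (suc zero) (suc zero) a b e with a ≟ b
... | yes refl = keep
... | no _     = contradiction e λ ()
flipStep-sound (suc zero) zero _ _ ()

flipStep-complete : ∀ {p q a b} → FlipStep p q a b → flipStep p q a b ≡ true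
flipStep-complete (keep {zero}     {a}) = dec-true (a ≟ a) refl
flipStep-complete (keep {suc zero} {a}) = dec-true (a ≟ a) refl
flipStep-complete (flip {a} {b} a≢b)    = cong not (dec-false (a ≟ b) a≢b)

-- State 0: no differing position read yet; state 1: exactly one read.
adjacency : NFA (Bool ⊗² Bool) 2
adjacency = record { δ = readPair ; initial = ⁅ zero ⁆ ; final = ⁅ suc zero ⁆ }
  where
  readPair : Fin 2 → Maybe (Bool ⊗² Bool) → Fin 2 → Bool
  readPair p (just (just a , just b)) q = flipStep p q a b
  readPair _ _                        _ = false

data Adjacent : Vec Bool k → Vec Bool k → Set where
  here  : ∀ {a b} {xs : Vec Bool k} → a ≢ b → Adjacent (a ∷ xs) (b ∷ xs)
  there : ∀ {a} {xs ys : Vec Bool k} → Adjacent xs ys → Adjacent (a ∷ xs) (a ∷ ys)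

lookup-ext : ∀ {xs ys : Vec Γ k} → (∀ i → lookup xs i ≡ lookup ys i) → xs ≡ ys
lookup-ext {xs = xs} {ys} same =
  trans (sym (tabulate∘lookup xs)) (trans (tabulate-cong same) (tabulate∘lookup ys))

edge⇒Adjacent : ∀ {x y : Vec Bool k} → E (Hypercube k) x y → Adjacent x y
edge⇒Adjacent {x = a ∷ xs} {b ∷ ys} (zero , a≢b , same)
  rewrite lookup-ext {xs = xs} {ys} (λ j → same (suc j) λ ()) = here a≢b
edge⇒Adjacent {x = a ∷ xs} {b ∷ ys} (suc i , differ , same)
  rewrite same zero λ () =
    there (edge⇒Adjacent (i , differ , λ j j≢i → same (suc j) (j≢i ∘ suc-injective)))

Adjacent⇒edge : ∀ {x y : Vec Bool k} → Adjacent x y → E (Hypercube k) x y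
Adjacent⇒edge (here a≢b) = zero , a≢b , λ { zero 0≢0 → contradiction refl 0≢0 ; (suc _) _ → refl }
Adjacent⇒edge (there adj) =
  let i , differ , same = Adjacent⇒edge adj
  in suc i , differ , λ { zero _ → refl ; (suc j) j≢i → same j (j≢i ∘ cong suc) }

Hypercube-edge⇔Adjacent : ∀ (x y : Vec Bool k) → E (Hypercube k) x y ⇔ Adjacent x y
Hypercube-edge⇔Adjacent _ _ = mk⇔ edge⇒Adjacent Adjacent⇒edge

pairs : Vec Bool k → Vec Bool k → List (Maybe (Bool ⊗² Bool))
pairs x y = map just (toList x ⊗ toList y)

Phase : Fin 2 → Vec Bool k → Vec Bool k → Set
Phase zero       x y = Adjacent x y
Phase (suc zero) x y = x ≡ y

Reaches⇒Phase : ∀ p (x y : Vec Bool k) → Reaches adjacency (pairs x y) p → Phase p x y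
Reaches⇒Phase zero       []      []      ()
Reaches⇒Phase (suc zero) []      []      _ = refl
Reaches⇒Phase p          (a ∷ x) (b ∷ y) (q , t , reach)
  with flipStep-sound p q a b t | Reaches⇒Phase q x y reach
... | keep {zero}     | adj  = there adj
... | keep {suc zero} | refl = refl
... | flip a≢b        | refl = here a≢b

Phase⇒Reaches : ∀ p {x y : Vec Bool k} → Phase p x y → Reaches adjacency (pairs x y) p
Phase⇒Reaches zero       (here a≢b) =
  suc zero , flipStep-complete (flip a≢b) , Phase⇒Reaches (suc zero) refl
Phase⇒Reaches zero       (there {a = a} adj) =
  zero , flipStep-complete (keep {zero} {a}) , Phase⇒Reaches zero adj
Phase⇒Reaches (suc zero) {[]}    refl = x∈⁅x⁆ (suc zero)
Phase⇒Reaches (suc zero) {a ∷ _} refl =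
  suc zero , flipStep-complete (keep {suc zero} {a}) , Phase⇒Reaches (suc zero) refl

Reaches-adjacency⇒⊗ : ∀ s {p} → Reaches adjacency (map just s) p →
  Σ[ u ∈ List Bool ] Σ[ v ∈ List Bool ] s ≡ u ⊗ v × length u ≡ length s × length v ≡ length s
Reaches-adjacency⇒⊗ [] _ = [] , [] , refl , refl , refl
Reaches-adjacency⇒⊗ ((just a , just b) ∷ s) (_ , _ , reach) =
  let u , v , s≡u⊗v , |u| , |v| = Reaches-adjacency⇒⊗ s reach
  in a ∷ u , b ∷ v , cong (_ ∷_) s≡u⊗v , cong suc |u| , cong suc |v|
Reaches-adjacency⇒⊗ ((nothing , _) ∷ _)      (_ , () , _)
Reaches-adjacency⇒⊗ ((just _ , nothing) ∷ _) (_ , () , _)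

length-toList-⊗ : ∀ (x y : Vec Γ k) → length (toList x ⊗ toList y) ≡ k
length-toList-⊗ []      []      = refl
length-toList-⊗ (_ ∷ x) (_ ∷ y) = cong suc (length-toList-⊗ x y)

adjacency-rejects-padding : RejectsPadding adjacency
adjacency-rejects-padding _ _ = refl

module _ {D} (U : Unrolls adjacency true D) where

  private
    accepts = Accepts⇔AcceptsOfLength adjacency-rejects-padding U

  Accepts-adjacency⇒⊗ : ∀ s → Accepts D s →
    Σ[ u ∈ List Bool ] Σ[ v ∈ List Bool ] s ≡ u ⊗ v × length u ≡ length D × length v ≡ length D
  Accepts-adjacency⇒⊗ s acc =
    let |s| , _ , _ , reach = Equivalence.to (accepts s) acc
        u , v , s≡u⊗v , |u| , |v| = Reaches-adjacency⇒⊗ s reach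
    in u , v , s≡u⊗v , trans |u| |s| , trans |v| |s|

  Accepts-adjacency⇔Adjacent : ∀ (x y : Vec Bool k) → k ≡ length D →
    Accepts D (toList x ⊗ toList y) ⇔ Adjacent x y
  Accepts-adjacency⇔Adjacent x y k≡D = mk⇔ to from
    where
    to : Accepts D (toList x ⊗ toList y) → Adjacent x y
    to acc with Equivalence.to (accepts _) acc
    ... | _ , p , p∈I , reach with x∈⁅y⁆⇒x≡y zero p∈I
    ...   | refl = Reaches⇒Phase zero x y reach
    from : Adjacent x y → Accepts D (toList x ⊗ toList y)
    from adj = Equivalence.from (accepts _)
      (trans (length-toList-⊗ x y) k≡D , zero , x∈⁅x⁆ zero , Phase⇒Reaches zero adj)

private variable
  A G : Graph
  D₀ : List (Layer Σ′ w)
  D₁ : List (Layer (Σ′ ⊗² Σ′) w)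

IsoDerived-transport : A ≅ G → IsoDerived G D₀ D₁ → IsoDerived A D₀ D₁
IsoDerived-transport (φ , edges-φ) (enc , accepted , injective , onto , edges) =
  enc ∘ to , accepted ∘ to ,
  (λ a b e → trans (sym (strictlyInverseʳ a))
                    (trans (cong from (injective _ _ e)) (strictlyInverseʳ b))) ,
  (λ u u∈L → let x , enc-x = onto u u∈L in from x , trans (cong enc (strictlyInverseˡ x)) enc-x) ,
  λ a b → edges (to a) (to b) ⇔-∘ edges-φ a b
  where open Inverse φ

IsoDerived-unique : {D₀ : List (Layer Σ′ w)} {D₁ : List (Layer (Σ′ ⊗² Σ′) w)} →
                    IsoDerived A D₀ D₁ → IsoDerived G D₀ D₁ → A ≅ G
IsoDerived-unique {A = A} {G = G} {D₁ = D₁}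
                  (encA , acceptedA , injectiveA , ontoA , edgesA)
                  (encG , acceptedG , injectiveG , ontoG , edgesG) =
  mk↔ₛ′ to from to∘from from∘to , edges
  where
  to : V A → V G
  to a = proj₁ (ontoG (encA a) (acceptedA a))
  from : V G → V A
  from x = proj₁ (ontoA (encG x) (acceptedG x))
  encG∘to : ∀ a → encG (to a) ≡ encA a
  encG∘to a = proj₂ (ontoG (encA a) (acceptedA a))
  encA∘from : ∀ x → encA (from x) ≡ encG x
  encA∘from x = proj₂ (ontoA (encG x) (acceptedG x))
  to∘from : ∀ x → to (from x) ≡ x
  to∘from x = injectiveG _ _ (trans (encG∘to (from x)) (encA∘from x))
  from∘to : ∀ a → from (to a) ≡ a
  from∘to a = injectiveA _ _ (trans (encA∘from (to a)) (encG∘to a))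
  edges : ∀ a b → E A a b ⇔ E G (to a) (to b)
  edges a b = ⇔-sym (subst₂ (λ u v → E G (to a) (to b) ⇔ Accepts D₁ (u ⊗ v)) (encG∘to a) (encG∘to b)
                             (edgesG (to a) (to b)))
              ⇔-∘ edgesA a b

search-Bool⊗Bool : Searchable (Bool ⊗² Bool)
search-Bool⊗Bool = search-× (search-Maybe search-Bool) (search-Maybe search-Bool)

open UnrollingPairs (letters {Bool} {1}) adjacency search-Bool search-Bool⊗Bool
  using (Unrollings; Unrollings-regular)

Unrollings⇒Structural : Unrollings D₀ D₁ → Structural Bool 2 D₀ D₁
Unrollings⇒Structural {D₀ = D₀} (U₀ , U₁ , len) =
  length D₀ , Unrolls⇒IsODD U₀ refl , Unrolls⇒IsODD U₁ (sym len) , λ s acc →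
    let u , v , s≡u⊗v , |u| , |v| = Accepts-adjacency⇒⊗ U₁ s acc
    in u , v , word (trans |u| (sym len)) , word (trans |v| (sym len)) , s≡u⊗v
  where word = λ {u} → Equivalence.from (Accepts-letters U₀ u)

Unrollings⇒Hypercube : Unrollings D₀ D₁ → IsoDerived (Hypercube (length D₀)) D₀ D₁
Unrollings⇒Hypercube {D₀ = D₀} (U₀ , U₁ , len) =
  toList , (λ x → Equivalence.from (Accepts-letters U₀ _) (length-toList x)) ,
  (λ x y e → trans (sym (cast-is-id refl x)) (toList-injective refl x y e)) , onto ,
  λ x y → ⇔-sym (Accepts-adjacency⇔Adjacent U₁ x y len) ⇔-∘ Hypercube-edge⇔Adjacent x y
  where
  onto : ∀ u → Accepts D₀ u → Σ[ x ∈ Vec Bool (length D₀) ] toList x ≡ u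
  onto u acc = subst (λ n → Σ[ x ∈ Vec Bool n ] toList x ≡ u)
                     (Equivalence.to (Accepts-letters U₀ u) acc) (fromList u , toList∘fromList u)

unrollings : ∀ n → Unrollings (unrolling letters true n) (unrolling adjacency true n)
unrollings n = unrolling-Unrolls letters true n , unrolling-Unrolls adjacency true n ,
               trans (length-unrolling letters true n) (sym (length-unrolling adjacency true n))

unrollings-Hypercube : ∀ n →
  IsoDerived (Hypercube (suc n)) (unrolling letters true n) (unrolling adjacency true n)
unrollings-Hypercube n =
  subst (λ k → IsoDerived (Hypercube k) (unrolling letters true n) (unrolling adjacency true n))
        (length-unrolling letters true n) (Unrollings⇒Hypercube (unrollings n))

proposition3 : RegularDecisional Bool 2 IsHypercube
proposition3 =
  Unrollings , (λ _ _ → Unrollings⇒Structural) , Unrollings-regular ,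
  λ _ → mk⇔ hypercube⇒derived derived⇒hypercube
  where
  DerivedFromUnrollings : Graph → Set
  DerivedFromUnrollings A = Σ[ D₀ ∈ _ ] Σ[ D₁ ∈ _ ] Unrollings D₀ D₁ × IsoDerived A D₀ D₁
  hypercube⇒derived : ∀ {A} → IsHypercube A → DerivedFromUnrollings A
  hypercube⇒derived (suc n , _ , A≅Hₖ) =
    _ , _ , unrollings n , IsoDerived-transport A≅Hₖ (unrollings-Hypercube n)
  derived⇒hypercube : ∀ {A} → DerivedFromUnrollings A → IsHypercube A
  derived⇒hypercube (D₀ , _ , U@(U₀ , _ , _) , derived) =
    length D₀ , Unrolls⇒length≥1 U₀ , IsoDerived-unique derived (Unrollings⇒Hypercube U)
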